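{- For the cycle graph $C_n$ ($n\geq 3$), $\mathcal{H}^1(C_n)\cong\mathbb{Z}/2\mathbb{Z}$.
   Context: For a finite simple graph $\Gamma$, $\Omega^1(\Gamma)$ is the real vector space of functions $f$ on ordered pairs $(v,w)$ of adjacent vertices with $f(v,w)=-f(w,v)$; the coboundary $D$ maps a vertex function $u$ to $Du(v,w)=u(w)-u(v)$; $H^1(\Gamma)=\Omega^1(\Gamma)/\mathrm{Im}(D)$. Each $g\in\mathrm{Aut}(\Gamma)$ acts by pullback $g^*f(v,w)=f(g(v),g(w))$, which descends to $H^1(\Gamma)$. The homomorphism $\phi^1_\Gamma:\mathrm{Aut}(\Gamma)\to GL(H^1(\Gamma))$ is $\phi^1_\Gamma(g)=(g^*)^{ -1}$ and $\mathcal{H}^1(\Gamma)$ denotes its image. -}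

module Defs where

open import Level using (Level; _⊔_)
open import Data.Nat as ℕ using (ℕ; zero; suc)
open import Data.Fin as Fin using (Fin; toℕ)
open import Data.Product using (Σ; ∃; _×_; _,_; proj₁)
open import Data.Sum using (_⊎_)
open import Relation.Nullary using (¬_)
open import Relation.Binary.PropositionalEquality using (_≡_; subst₂) renaming (sym to sym≡)
open import Function.Bundles using (_↔_; _⇔_; Inverse; Equivalence; mk⇔)
open import Function.Construct.Composition using (_↔-∘_)
open import Data.Nat using (_≤_)
open import Algebra.Bundles using (CommutativeRing)

record Field (c ℓ : Level) : Set (Level.suc (c ⊔ ℓ)) where
  field
    commRing : CommutativeRing c ℓ
  open CommutativeRing commRing public
  field
    1≉0      : ¬ (1# ≈ 0#)
    inverse  : ∀ x → ¬ (x ≈ 0#) → Σ Carrier λ y → x * y ≈ 1#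

_+₂_ : Fin 2 → Fin 2 → Fin 2
Fin.zero +₂ b = b
Fin.suc Fin.zero +₂ Fin.zero = Fin.suc Fin.zero
Fin.suc Fin.zero +₂ Fin.suc Fin.zero = Fin.zero

module _ {c ℓ : Level} (K : Field c ℓ) where
  open Field K
  ι : ℕ → Carrier
  ι zero    = 0#
  ι (suc m) = 1# + ι m

CharZero : ∀ {c ℓ} → Field c ℓ → Set ℓ
CharZero K = ∀ m → ¬ (Field._≈_ K (ι K (suc m)) (Field.0# K))

-- The cycle graph C_n: vertices Fin n = {0,…,n-1}, with i adjacent to
-- i+1 (mod n).  For n ≥ 3 this is a finite simple graph.

Next : (n : ℕ) → Fin n → Fin n → Set
Next n v w = (suc (toℕ v) ≡ toℕ w) ⊎ ((suc (toℕ v) ≡ n) × (toℕ w ≡ 0))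

CycleAdj : (n : ℕ) → Fin n → Fin n → Set
CycleAdj n v w = Next n v w ⊎ Next n w v

module _ (V : Set) (Adj : V → V → Set) where

  record Aut : Set where
    field
      perm : V ↔ V
    open Inverse perm public using (to; from)
    field
      pres : ∀ v w → Adj v w ⇔ Adj (to v) (to w)

  _∘A_ : Aut → Aut → Aut
  g ∘A h = record
    { perm = Aut.perm g ↔-∘ Aut.perm h
    ; pres = λ v w → mk⇔
        (λ a → Equivalence.to (Aut.pres g (Aut.to h v) (Aut.to h w))
                 (Equivalence.to (Aut.pres h v w) a))
        (λ a → Equivalence.from (Aut.pres h v w)
                 (Equivalence.from (Aut.pres g (Aut.to h v) (Aut.to h w)) a))
    }

  module _ {c ℓ : Level} (K : Field c ℓ) where
    open Field K

    -- Ω¹(Γ): functions on ordered adjacent pairs with f(v,w) = -f(w,v).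
    -- (Represented as f : V → V → K; only values on adjacent pairs matter.)
    Ω¹ : Set (c ⊔ ℓ)
    Ω¹ = Σ (V → V → Carrier) λ f → ∀ v w → Adj v w → f v w ≈ - f w v

    D : (V → Carrier) → (V → V → Carrier)
    D u v w = u w - u v

    -- H¹(Γ) = Ω¹(Γ)/Im(D), as a setoid on Ω¹:
    -- [f] = [f']  iff  f - f' ∈ Im(D)  (equality of 1-forms is on
    -- adjacent pairs).
    _≈H¹_ : Ω¹ → Ω¹ → Set (c ⊔ ℓ)
    (f , _) ≈H¹ (f' , _) =
      Σ (V → Carrier) λ u → ∀ v w → Adj v w → f v w - f' v w ≈ D u v w

    pull : Aut → Ω¹ → Ω¹
    pull g (f , anti) =
      (λ v w → f (Aut.to g v) (Aut.to g w)) ,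
      λ v w a → anti (Aut.to g v) (Aut.to g w) (Equivalence.to (Aut.pres g v w) a)

    -- φ¹_Γ(g) = (g*)⁻¹ = (g⁻¹)*, i.e. (φ¹ g f)(v,w) = f(g⁻¹ v, g⁻¹ w).
    φ¹ : Aut → Ω¹ → Ω¹
    φ¹ g (f , anti) =
      (λ v w → f (Aut.from g v) (Aut.from g w)) ,
      λ v w a → anti (Aut.from g v) (Aut.from g w)
        (Equivalence.from (Aut.pres g (Aut.from g v) (Aut.from g w))
          (subst₂ Adj (sym≡ (Inverse.strictlyInverseˡ (Aut.perm g) v))
                      (sym≡ (Inverse.strictlyInverseˡ (Aut.perm g) w)) a))

    -- Elements of the image 𝓗¹(Γ) = φ¹_Γ(Aut Γ) ⊆ GL(H¹(Γ)) are
    -- represented by automorphisms g, two of them being equal iff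
    -- φ¹ g and φ¹ h agree as linear maps of H¹(Γ).  The group law is
    -- φ¹ g ∘ φ¹ h = φ¹ (g ∘A h).
    _≈𝓗¹_ : Aut → Aut → Set (c ⊔ ℓ)
    g ≈𝓗¹ h = ∀ (f : Ω¹) → φ¹ g f ≈H¹ φ¹ h f

    𝓗¹≅ℤ/2ℤ : Set (c ⊔ ℓ)
    𝓗¹≅ℤ/2ℤ = Σ (Aut → Fin 2) λ ψ →
        (∀ g h → g ≈𝓗¹ h → ψ g ≡ ψ h)
      × (∀ g h → ψ g ≡ ψ h → g ≈𝓗¹ h)
      × (∀ (z : Fin 2) → Σ Aut λ g → ψ g ≡ z)
      × (∀ g h → ψ (g ∘A h) ≡ ψ g +₂ ψ h)

-- Every 1-form on the cycle is determined up to coboundaries by its circulation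
-- ∑ f(v-1, v), so H¹(Cₙ) is one-dimensional.  An automorphism of Cₙ (n ≥ 3) is
-- either a rotation, which preserves the orientation of every edge and hence the
-- circulation, or a reflection, which reverses every edge and negates it.  So
-- φ¹(g) acts on H¹(Cₙ) as +1 or −1 according to the type of g, and these differ
-- because the winding form has circulation n ≠ 0 in characteristic zero.
module Submission where

open import Defs
open import Level using (Level)
open import Data.Bool using (if_then_else_)
open import Data.Nat as ℕ using (ℕ; zero; suc; _≤_; _∸_; s≤s)
import Data.Nat.Properties as ℕ
open import Data.Fin using (Fin; zero; suc; toℕ; inject₁; fromℕ; opposite)
open import Data.Fin.Properties
  using (toℕ-injective; toℕ-inject₁; toℕ-fromℕ; toℕ<n; fromℕ≢inject₁; inject₁-injective;
         opposite-prop; opposite-involutive; _≟_)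
open import Data.Fin.Induction using (<-weakInduction)
open import Data.Vec.Functional using (Vector; tail)
open import Data.Product using (Σ; _,_; proj₁; proj₂)
open import Data.Sum as Sum using (inj₁; inj₂; _⊎_)
open import Data.Empty using (⊥; ⊥-elim)
open import Relation.Nullary using (¬_; Dec; does)
open import Relation.Nullary.Decidable using (dec-true; dec-false)
open import Relation.Binary.PropositionalEquality as ≡ using (_≡_; _≢_; refl; cong; module ≡-Reasoning)
open import Function using (_∘_; Injective; Injection)
open import Function.Bundles using (Inverse; Equivalence; mk⇔; mk↔ₛ′)
open import Function.Construct.Identity using (↔-id; ⇔-id)
open import Function.Construct.Symmetry using (↔-sym)
open import Function.Properties.Inverse using (↔⇒↣)
open import Algebra.Bundles using (AbelianGroup)

prev : ∀ {m} → Fin (suc m) → Fin (suc m)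
prev {m} zero = fromℕ m
prev (suc i) = inject₁ i

prev-injective : ∀ {m} {v w : Fin (suc m)} → prev v ≡ prev w → v ≡ w
prev-injective {v = zero}  {zero}  _ = refl
prev-injective {v = zero}  {suc j} e = ⊥-elim (fromℕ≢inject₁ e)
prev-injective {v = suc i} {zero}  e = ⊥-elim (fromℕ≢inject₁ (≡.sym e))
prev-injective {v = suc i} {suc j} e = cong suc (inject₁-injective e)

prev-Next : ∀ {m} (w : Fin (suc m)) → Next (suc m) (prev w) w
prev-Next {m} zero = inj₂ (cong suc (toℕ-fromℕ m) , refl)
prev-Next (suc i) = inj₁ (cong suc (toℕ-inject₁ i))

Next⇒≡prev : ∀ {m} {v w : Fin (suc m)} → Next (suc m) v w → v ≡ prev w
Next⇒≡prev {m} {w = zero} (inj₂ (e , _)) =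
  toℕ-injective (≡.trans (ℕ.suc-injective e) (≡.sym (toℕ-fromℕ m)))
Next⇒≡prev {w = suc i} (inj₁ e) =
  toℕ-injective (≡.trans (ℕ.suc-injective e) (≡.sym (toℕ-inject₁ i)))

CycleAdj⇒prev : ∀ {m} {v w : Fin (suc m)} → CycleAdj (suc m) v w → v ≡ prev w ⊎ w ≡ prev v
CycleAdj⇒prev = Sum.map Next⇒≡prev Next⇒≡prev

Next-opposite : ∀ {n} {v w : Fin n} → Next n v w → Next n (opposite w) (opposite v)
Next-opposite {n} {v} {w} (inj₁ e) = inj₁ (begin
  suc (toℕ (opposite w))   ≡⟨ cong suc (opposite-prop w) ⟩
  suc (n ∸ suc (toℕ w))    ≡⟨ ℕ.+-∸-assoc 1 (toℕ<n w) ⟨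
  n ∸ toℕ w                ≡⟨ cong (n ∸_) e ⟨
  n ∸ suc (toℕ v)          ≡⟨ opposite-prop v ⟨
  toℕ (opposite v)         ∎)
  where open ≡-Reasoning
Next-opposite {n} {v} {w} (inj₂ (e₁ , e₂)) = inj₂ (last , first)
  where
  open ≡-Reasoning
  last : suc (toℕ (opposite w)) ≡ n
  last = begin
    suc (toℕ (opposite w))   ≡⟨ cong suc (opposite-prop w) ⟩
    suc (n ∸ suc (toℕ w))    ≡⟨ cong (λ t → suc (n ∸ suc t)) e₂ ⟩
    suc (n ∸ 1)              ≡⟨ cong (λ t → suc (t ∸ 1)) e₁ ⟨
    suc (toℕ v)              ≡⟨ e₁ ⟩
    n                        ∎
  first : toℕ (opposite v) ≡ 0
  first = ≡.trans (opposite-prop v) (≡.trans (cong (n ∸_) e₁) (ℕ.n∸n≡0 n))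

CycleAdj-opposite : ∀ {n} {v w : Fin n} → CycleAdj n v w → CycleAdj n (opposite v) (opposite w)
CycleAdj-opposite = Sum.swap ∘ Sum.map Next-opposite Next-opposite

prev∘prev≢id : ∀ {k} (v : Fin (3 ℕ.+ k)) → prev (prev v) ≢ v
prev∘prev≢id zero ()
prev∘prev≢id (suc zero) ()
prev∘prev≢id (suc (suc i)) e =
  ℕ.m≢1+n+m (toℕ i) (≡.trans (≡.sym (≡.trans (toℕ-inject₁ (inject₁ i)) (toℕ-inject₁ i))) (cong toℕ e))

IsRotation : ∀ {m} → (Fin (suc m) → Fin (suc m)) → Set
IsRotation σ = ∀ v → σ (prev v) ≡ prev (σ v)

IsReflection : ∀ {m} → (Fin (suc m) → Fin (suc m)) → Set
IsReflection σ = ∀ v → σ v ≡ prev (σ (prev v))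

HasOrientation : ∀ {m} → (Fin (suc m) → Fin (suc m)) → Fin 2 → Set
HasOrientation σ zero       = IsRotation σ
HasOrientation σ (suc zero) = IsReflection σ

HasOrientation-∘ : ∀ {m} {σ τ : Fin (suc m) → Fin (suc m)} a b →
  HasOrientation σ a → HasOrientation τ b → HasOrientation (σ ∘ τ) (a +₂ b)
HasOrientation-∘ {σ = σ} {τ} zero zero σ↻ τ↻ v =
  ≡.trans (cong σ (τ↻ v)) (σ↻ (τ v))
HasOrientation-∘ {σ = σ} {τ} zero (suc zero) σ↻ τ⇄ v =
  ≡.trans (cong σ (τ⇄ v)) (σ↻ (τ (prev v)))
HasOrientation-∘ {σ = σ} {τ} (suc zero) zero σ⇄ τ↻ v =
  ≡.trans (σ⇄ (τ v)) (cong (prev ∘ σ) (≡.sym (τ↻ v)))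
HasOrientation-∘ {σ = σ} {τ} (suc zero) (suc zero) σ⇄ τ⇄ v =
  ≡.trans (σ⇄ (τ (prev v))) (cong (prev ∘ σ) (≡.sym (τ⇄ v)))

HasOrientation-inverse : ∀ {m} {σ τ : Fin (suc m) → Fin (suc m)} a →
  (∀ v → σ (τ v) ≡ v) → (∀ v → τ (σ v) ≡ v) → HasOrientation σ a → HasOrientation τ a
HasOrientation-inverse {σ = σ} {τ} zero στ τσ σ↻ v = begin
  τ (prev v)             ≡⟨ cong (τ ∘ prev) (στ v) ⟨
  τ (prev (σ (τ v)))     ≡⟨ cong τ (σ↻ (τ v)) ⟨
  τ (σ (prev (τ v)))     ≡⟨ τσ (prev (τ v)) ⟩
  prev (τ v)             ∎
  where open ≡-Reasoning
HasOrientation-inverse {σ = σ} {τ} (suc zero) στ τσ σ⇄ v = begin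
  τ v                    ≡⟨ cong τ (prev-injective (≡.trans (≡.sym (στ (prev v))) (σ⇄ (τ (prev v))))) ⟩
  τ (σ (prev (τ (prev v)))) ≡⟨ τσ _ ⟩
  prev (τ (prev v))      ∎
  where open ≡-Reasoning

rotation-reflection-exclusive : ∀ {k} {σ : Fin (3 ℕ.+ k) → Fin (3 ℕ.+ k)} →
  IsRotation σ → IsReflection σ → ⊥
rotation-reflection-exclusive {σ = σ} σ↻ σ⇄ =
  prev∘prev≢id (σ zero) (≡.sym (≡.trans (σ⇄ zero) (cong prev (σ↻ zero))))

HasOrientation-unique : ∀ {k} {σ : Fin (3 ℕ.+ k) → Fin (3 ℕ.+ k)} a b →
  HasOrientation σ a → HasOrientation σ b → a ≡ b
HasOrientation-unique zero       zero       _  _  = refl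
HasOrientation-unique zero       (suc zero) σ↻ σ⇄ = ⊥-elim (rotation-reflection-exclusive σ↻ σ⇄)
HasOrientation-unique (suc zero) zero       σ⇄ σ↻ = ⊥-elim (rotation-reflection-exclusive σ↻ σ⇄)
HasOrientation-unique (suc zero) (suc zero) _  _  = refl

-- An injective self-map of Cₙ (n ≥ 3) sending edges to edges is a rotation or a
-- reflection: the orientation of one edge propagates around the cycle, since
-- flipping it at some edge would force σ to identify w with prev (prev w).
module EdgeMap {k} {σ : Fin (3 ℕ.+ k) → Fin (3 ℕ.+ k)} (σ-injective : Injective _≡_ _≡_ σ)
  (edge-image : ∀ w → σ (prev w) ≡ prev (σ w) ⊎ σ w ≡ prev (σ (prev w))) where

  rotation-step : ∀ w → σ (prev (prev w)) ≡ prev (σ (prev w)) → σ (prev w) ≡ prev (σ w)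
  rotation-step w previous with edge-image w
  ... | inj₁ rotated = rotated
  ... | inj₂ reflected =
    ⊥-elim (prev∘prev≢id w (≡.sym (σ-injective (≡.trans reflected (≡.sym previous)))))

  reflection-step : ∀ w → σ (prev w) ≡ prev (σ (prev (prev w))) → σ w ≡ prev (σ (prev w))
  reflection-step w previous with edge-image w
  ... | inj₂ reflected = reflected
  ... | inj₁ rotated =
    ⊥-elim (prev∘prev≢id w (≡.sym (σ-injective (prev-injective (≡.trans (≡.sym rotated) previous)))))

  classify : Σ (Fin 2) (HasOrientation σ)
  classify with edge-image zero
  ... | inj₁ rotated =
    zero , <-weakInduction (λ v → σ (prev v) ≡ prev (σ v)) rotated (rotation-step ∘ suc)
  ... | inj₂ reflected =
    suc zero , <-weakInduction (λ v → σ v ≡ prev (σ (prev v))) reflected (reflection-step ∘ suc)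

module CycleSums {a ℓ} (G : AbelianGroup a ℓ) where
  open AbelianGroup G renaming (refl to ≈-refl)
  open import Algebra.Properties.AbelianGroup G using (xyx⁻¹≈y; ⁻¹-∙-comm; inverseˡ-unique; ε⁻¹≈ε)
  open import Algebra.Properties.CommutativeMonoid.Sum commutativeMonoid
    using (sum; ∑-distrib-+; sum-init-last)
  open import Relation.Binary.Reasoning.Setoid setoid

  ∑-distrib-⁻¹ : ∀ {k} (f : Vector Carrier k) → sum (λ i → f i ⁻¹) ≈ sum f ⁻¹
  ∑-distrib-⁻¹ {zero}  f = sym ε⁻¹≈ε
  ∑-distrib-⁻¹ {suc k} f = trans (∙-congˡ (∑-distrib-⁻¹ (tail f))) (⁻¹-∙-comm _ _)

  ∑-distrib-- : ∀ {k} (f g : Vector Carrier k) → sum (λ i → f i - g i) ≈ sum f - sum g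
  ∑-distrib-- f g = trans (∑-distrib-+ f (λ i → g i ⁻¹)) (∙-congˡ (∑-distrib-⁻¹ g))

  sum-∘-prev : ∀ {m} (u : Vector Carrier (suc m)) → sum (u ∘ prev) ≈ sum u
  sum-∘-prev u = trans (comm _ _) (sym (sum-init-last u))

  ∑-prev-differences≈ε : ∀ {m} (u : Vector Carrier (suc m)) → sum (λ w → u w - u (prev w)) ≈ ε
  ∑-prev-differences≈ε u = begin
    sum (λ w → u w - u (prev w)) ≈⟨ ∑-distrib-- u (u ∘ prev) ⟩
    sum u - sum (u ∘ prev)       ≈⟨ ∙-congˡ (⁻¹-cong (sum-∘-prev u)) ⟩
    sum u - sum u                ≈⟨ inverseʳ (sum u) ⟩
    ε                            ∎

  partialSum : ∀ {k} → Vector Carrier k → Vector Carrier (suc k)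
  partialSum c zero = ε
  partialSum {suc k} c (suc i) = c zero ∙ partialSum (tail c) i

  partialSum-suc : ∀ {k} (c : Vector Carrier k) (i : Fin k) →
    partialSum c (suc i) ≈ partialSum c (inject₁ i) ∙ c i
  partialSum-suc c zero = trans (identityʳ _) (sym (identityˡ _))
  partialSum-suc c (suc i) =
    trans (∙-congˡ (partialSum-suc (tail c) i)) (sym (assoc _ _ _))

  partialSum-last : ∀ {k} (c : Vector Carrier k) → partialSum c (fromℕ k) ≈ sum c
  partialSum-last {zero}  c = ≈-refl
  partialSum-last {suc k} c = ∙-congˡ (partialSum-last (tail c))

  ∑≈ε⇒prev-differences : ∀ {m} (e : Vector Carrier (suc m)) → sum e ≈ ε →
    Σ (Vector Carrier (suc m)) λ u → ∀ w → u w - u (prev w) ≈ e w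
  ∑≈ε⇒prev-differences {m} e ∑e≈ε = u , difference
    where
    u : Vector Carrier (suc m)
    u = partialSum (tail e)
    difference : ∀ w → u w - u (prev w) ≈ e w
    difference zero = begin
      ε ∙ u (fromℕ m) ⁻¹      ≈⟨ identityˡ _ ⟩
      u (fromℕ m) ⁻¹          ≈⟨ ⁻¹-cong (partialSum-last (tail e)) ⟩
      sum (tail e) ⁻¹         ≈⟨ inverseˡ-unique _ _ ∑e≈ε ⟨
      e zero                  ∎
    difference (suc i) = begin
      u (suc i) - u (inject₁ i)                  ≈⟨ ∙-congʳ (partialSum-suc (tail e) i) ⟩
      u (inject₁ i) ∙ e (suc i) - u (inject₁ i)  ≈⟨ xyx⁻¹≈y _ _ ⟩
      e (suc i)                                  ∎

module CycleAutomorphisms (k : ℕ) where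
  private
    n : ℕ
    n = 3 ℕ.+ k
    Autₙ : Set
    Autₙ = Aut (Fin n) (CycleAdj n)

  edge-image : (g : Autₙ) → ∀ w →
    Aut.to g (prev w) ≡ prev (Aut.to g w) ⊎ Aut.to g w ≡ prev (Aut.to g (prev w))
  edge-image g w = CycleAdj⇒prev (Equivalence.to (Aut.pres g (prev w) w) (inj₁ (prev-Next w)))

  classify : (g : Autₙ) → Σ (Fin 2) (HasOrientation (Aut.to g))
  classify g = EdgeMap.classify (Injection.injective (↔⇒↣ (Aut.perm g))) (edge-image g)

  orientation : Autₙ → Fin 2
  orientation g = proj₁ (classify g)

  orientation-to : (g : Autₙ) → HasOrientation (Aut.to g) (orientation g)
  orientation-to g = proj₂ (classify g)

  orientation-from : (g : Autₙ) → HasOrientation (Aut.from g) (orientation g)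
  orientation-from g = HasOrientation-inverse (orientation g)
    (Inverse.strictlyInverseˡ (Aut.perm g)) (Inverse.strictlyInverseʳ (Aut.perm g)) (orientation-to g)

  orientation-∘A : ∀ g h → orientation (_∘A_ (Fin n) (CycleAdj n) g h) ≡ orientation g +₂ orientation h
  orientation-∘A g h = HasOrientation-unique _ _ (orientation-to (_∘A_ (Fin n) (CycleAdj n) g h))
    (HasOrientation-∘ (orientation g) (orientation h) (orientation-to g) (orientation-to h))

  identity : Autₙ
  identity = record { perm = ↔-id _ ; pres = λ _ _ → ⇔-id _ }

  reversal : Autₙ
  reversal = record
    { perm = mk↔ₛ′ opposite opposite opposite-involutive opposite-involutive
    ; pres = λ v w → mk⇔ CycleAdj-opposite
        (λ a → ≡.subst₂ (CycleAdj n) (opposite-involutive v) (opposite-involutive w) (CycleAdj-opposite a))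
    }

  opposite-isReflection : IsReflection {2 ℕ.+ k} opposite
  opposite-isReflection v = Next⇒≡prev (Next-opposite (prev-Next v))

  orientation-surjective : ∀ z → Σ Autₙ λ g → orientation g ≡ z
  orientation-surjective zero =
    identity , HasOrientation-unique {σ = Aut.to identity} _ zero (orientation-to identity) (λ _ → refl)
  orientation-surjective (suc zero) =
    reversal , HasOrientation-unique _ (suc zero) (orientation-to reversal) opposite-isReflection

module _ {a ℓ} (K : Field a ℓ) where
  open Field K hiding (zero; refl)
  open import Algebra.Properties.Monoid.Mult +-monoid using (_×_; ×-homo-+)
  open import Relation.Binary.Reasoning.Setoid setoid

  ι≈×1# : ∀ n → ι K n ≈ n × 1#
  ι≈×1# zero    = Field.refl K
  ι≈×1# (suc n) = +-congˡ (ι≈×1# n)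

  ι≉-ι : CharZero K → ∀ m → ¬ (ι K (suc m) ≈ - ι K (suc m))
  ι≉-ι charZero m ι≈-ι = charZero (m ℕ.+ suc m) (begin
    ι K (suc m ℕ.+ suc m)        ≈⟨ ι≈×1# (suc m ℕ.+ suc m) ⟩
    (suc m ℕ.+ suc m) × 1#       ≈⟨ ×-homo-+ 1# (suc m) (suc m) ⟩
    suc m × 1# + suc m × 1#      ≈⟨ +-cong (ι≈×1# (suc m)) (ι≈×1# (suc m)) ⟨
    ι K (suc m) + ι K (suc m)    ≈⟨ +-congˡ ι≈-ι ⟩
    ι K (suc m) - ι K (suc m)    ≈⟨ -‿inverseʳ (ι K (suc m)) ⟩
    0#                           ∎)

module CycleCohomology {a ℓ} (K : Field a ℓ) (m : ℕ) where
  open Field K hiding (zero; refl)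
  open CycleSums +-abelianGroup
  open import Algebra.Properties.AbelianGroup +-abelianGroup
    using (x∙y⁻¹≈ε⇒x≈y; x≈y⇒x∙y⁻¹≈ε; ⁻¹-∙-comm; ⁻¹-anti-homo‿-; ε⁻¹≈ε)
  open import Algebra.Properties.CommutativeMonoid.Sum +-commutativeMonoid
    using (sum; sum-cong-≋; sum-permute; sum-replicate)
  open import Algebra.Properties.Monoid.Mult +-monoid using (_×_)
  open import Relation.Binary.Reasoning.Setoid setoid

  private
    V : Set
    V = Fin (suc m)
    Adj : V → V → Set
    Adj = CycleAdj (suc m)

  circulation : Ω¹ V Adj K → Carrier
  circulation (f , _) = sum λ w → f (prev w) w

  circulation-cong : ∀ F F' → _≈H¹_ V Adj K F F' → circulation F ≈ circulation F'
  circulation-cong (f , _) (f' , _) (u , f-f'≈Du) = x∙y⁻¹≈ε⇒x≈y _ _ (begin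
    sum (λ w → f (prev w) w) - sum (λ w → f' (prev w) w) ≈⟨ ∑-distrib-- (λ w → f (prev w) w) (λ w → f' (prev w) w) ⟨
    sum (λ w → f (prev w) w - f' (prev w) w)             ≈⟨ sum-cong-≋ (λ w → f-f'≈Du (prev w) w (inj₁ (prev-Next w))) ⟩
    sum (λ w → u w - u (prev w))                         ≈⟨ ∑-prev-differences≈ε u ⟩
    0#                                                   ∎)

  circulation-injective : ∀ F F' → circulation F ≈ circulation F' → _≈H¹_ V Adj K F F'
  circulation-injective (f , f-anti) (f' , f'-anti) same = u , f-f'≈Du
    where
    d : V → V → Carrier
    d v w = f v w - f' v w
    potential : Σ (V → Carrier) λ u → ∀ w → u w - u (prev w) ≈ d (prev w) w
    potential = ∑≈ε⇒prev-differences (λ w → d (prev w) w)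
      (trans (∑-distrib-- (λ w → f (prev w) w) (λ w → f' (prev w) w)) (x≈y⇒x∙y⁻¹≈ε same))
    u : V → Carrier
    u = proj₁ potential
    f-f'≈Du : ∀ v w → Adj v w → d v w ≈ u w - u v
    f-f'≈Du v w adj with CycleAdj⇒prev adj
    ... | inj₁ refl = sym (proj₂ potential w)
    ... | inj₂ refl = begin
      f v (prev v) - f' v (prev v)            ≈⟨ +-cong (f-anti _ _ adj) (-‿cong (f'-anti _ _ adj)) ⟩
      - f (prev v) v - - f' (prev v) v        ≈⟨ ⁻¹-∙-comm _ _ ⟩
      - d (prev v) v                          ≈⟨ -‿cong (proj₂ potential v) ⟨
      - (u v - u (prev v))                    ≈⟨ ⁻¹-anti-homo‿- _ _ ⟩
      u (prev v) - u v                        ∎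

  sign : Fin 2 → Carrier → Carrier
  sign zero       x = x
  sign (suc zero) x = - x

  sign-injective : ∀ {x} → ¬ (x ≈ - x) → ∀ a b → sign a x ≈ sign b x → a ≡ b
  sign-injective x≉-x zero       zero       _ = refl
  sign-injective x≉-x zero       (suc zero) e = ⊥-elim (x≉-x e)
  sign-injective x≉-x (suc zero) zero       e = ⊥-elim (x≉-x (sym e))
  sign-injective x≉-x (suc zero) (suc zero) _ = refl

  circulation-φ¹ : ∀ (g : Aut V Adj) a → HasOrientation (Aut.from g) a → ∀ F →
    circulation (φ¹ V Adj K g F) ≈ sign a (circulation F)
  circulation-φ¹ g zero τ↻ (f , _) = begin
    sum (λ w → f (τ (prev w)) (τ w))   ≈⟨ sum-cong-≋ (λ w → reflexive (cong (λ x → f x (τ w)) (τ↻ w))) ⟩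
    sum (c ∘ τ)                        ≈⟨ sum-permute c (↔-sym (Aut.perm g)) ⟨
    sum c                              ∎
    where
    τ : V → V
    τ = Aut.from g
    c : V → Carrier
    c w = f (prev w) w
  circulation-φ¹ g (suc zero) τ⇄ (f , f-anti) = begin
    sum (λ w → f (τ (prev w)) (τ w))   ≈⟨ sum-cong-≋ reversed ⟩
    sum (λ w → - c (τ (prev w)))       ≈⟨ ∑-distrib-⁻¹ (c ∘ τ ∘ prev) ⟩
    - sum (c ∘ τ ∘ prev)               ≈⟨ -‿cong (sum-∘-prev (c ∘ τ)) ⟩
    - sum (c ∘ τ)                      ≈⟨ -‿cong (sum-permute c (↔-sym (Aut.perm g))) ⟨
    - sum c                            ∎
    where
    τ : V → V
    τ = Aut.from g
    c : V → Carrier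
    c w = f (prev w) w
    reversed : ∀ w → f (τ (prev w)) (τ w) ≈ - c (τ (prev w))
    reversed w = trans (reflexive (cong (f (τ (prev w))) (τ⇄ w))) (f-anti _ _ (inj₂ (prev-Next _)))

  𝟙 : {P : Set} → Dec P → Carrier
  𝟙 p = if does p then 1# else 0#

  windingForm : Ω¹ V Adj K
  windingForm = (λ v w → 𝟙 (v ≟ prev w) - 𝟙 (w ≟ prev v)) , λ v w _ → sym (⁻¹-anti-homo‿- _ _)

  circulation-windingForm : (∀ w → prev (prev w) ≢ w) → circulation windingForm ≈ ι K (suc m)
  circulation-windingForm prev²≢id = begin
    circulation windingForm   ≈⟨ sum-cong-≋ {suc m} forward-edge ⟩
    sum {suc m} (λ _ → 1#)    ≈⟨ sum-replicate (suc m) ⟩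
    suc m × 1#                ≈⟨ ι≈×1# K (suc m) ⟨
    ι K (suc m)               ∎
    where
    forward-edge : ∀ (w : V) → 𝟙 (prev w ≟ prev w) - 𝟙 (w ≟ prev (prev w)) ≈ 1#
    forward-edge w
      rewrite dec-true (prev w ≟ prev w) refl
            | dec-false (w ≟ prev (prev w)) (prev²≢id w ∘ ≡.sym)
      = trans (+-congˡ ε⁻¹≈ε) (+-identityʳ 1#)

module CycleH¹ {a ℓ} (K : Field a ℓ) (charZero : CharZero K) (k : ℕ) where
  open Field K hiding (zero; refl)
  open CycleAutomorphisms k public
  open CycleCohomology K (2 ℕ.+ k)
  open import Relation.Binary.Reasoning.Setoid setoid

  private
    n : ℕ
    n = 3 ℕ.+ k
    φ : Aut (Fin n) (CycleAdj n) → Ω¹ (Fin n) (CycleAdj n) K → Ω¹ (Fin n) (CycleAdj n) K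
    φ = φ¹ (Fin n) (CycleAdj n) K

  circulation-φ¹-orientation : ∀ g F →
    circulation (φ g F) ≈ sign (orientation g) (circulation F)
  circulation-φ¹-orientation g = circulation-φ¹ g (orientation g) (orientation-from g)

  windingForm-not-self-negating : ¬ (circulation windingForm ≈ - circulation windingForm)
  windingForm-not-self-negating w≈-w = ι≉-ι K charZero (2 ℕ.+ k) (begin
    ι K n                        ≈⟨ circulation-windingForm prev∘prev≢id ⟨
    circulation windingForm      ≈⟨ w≈-w ⟩
    - circulation windingForm    ≈⟨ -‿cong (circulation-windingForm prev∘prev≢id) ⟩
    - ι K n                      ∎)

  orientation-respects-≈𝓗¹ : ∀ g h → _≈𝓗¹_ (Fin n) (CycleAdj n) K g h → orientation g ≡ orientation h
  orientation-respects-≈𝓗¹ g h g≈h =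
    sign-injective windingForm-not-self-negating (orientation g) (orientation h) (begin
      sign (orientation g) (circulation windingForm)     ≈⟨ circulation-φ¹-orientation g windingForm ⟨
      circulation (φ g windingForm)                      ≈⟨ circulation-cong (φ g windingForm) (φ h windingForm) (g≈h windingForm) ⟩
      circulation (φ h windingForm)                      ≈⟨ circulation-φ¹-orientation h windingForm ⟩
      sign (orientation h) (circulation windingForm)     ∎)

  orientation-injective : ∀ g h → orientation g ≡ orientation h → _≈𝓗¹_ (Fin n) (CycleAdj n) K g h
  orientation-injective g h same F = circulation-injective (φ g F) (φ h F) (begin
    circulation (φ g F)                      ≈⟨ circulation-φ¹-orientation g F ⟩
    sign (orientation g) (circulation F)     ≡⟨ cong (λ o → sign o (circulation F)) same ⟩
    sign (orientation h) (circulation F)     ≈⟨ circulation-φ¹-orientation h F ⟨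
    circulation (φ h F)                      ∎)

corollary3p10 : ∀ {c ℓ : Level} (K : Field c ℓ) → CharZero K →
    ∀ (n : ℕ) → 3 ≤ n → 𝓗¹≅ℤ/2ℤ (Fin n) (CycleAdj n) K
corollary3p10 K charZero (suc (suc (suc k))) (s≤s (s≤s (s≤s _))) =
  orientation , orientation-respects-≈𝓗¹ , orientation-injective , orientation-surjective , orientation-∘A
  where open CycleH¹ K charZero k
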